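{- For every Slick rule $r$ and every agent $a$: if $\mathit{safe}(r)$ then $\mathit{safe}(\mathit{reflect}\text{ - }\mathit{author}(r,a))$.
   Context: Rosetrees over a type $t$: $\mathit{rosetree}(t) ::= \mathit{Leaf}(t) \mid \mathit{Node}(\mathit{list}(\mathit{rosetree}(t)))$. Facts: $\mathit{fact} := \mathit{rosetree}(\mathsf{string})$; agents are facts. Constants: $\mathit{Var}(\mathsf{string})\mid\mathit{Lit}(\mathsf{string})$; atoms: $\mathit{rosetree}(\mathit{constant})$. Signs: $\mathit{Pos}\mid\mathit{Neg}$. Conditions: $\mathit{True}(\mathit{atom})\mid\mathit{Same}(\mathit{list}(\mathit{atom}))\mid\mathit{Diff}(\mathit{list}(\mathit{atom}))$. A rule is a pair $(h,b)$ with head atom $h$ and body $b$ a finite list of (sign, condition) pairs. $\mathit{has}\text{ - }\mathit{var}(v,a)$ is inductively defined by $\mathit{has}\text{ - }\mathit{var}(v,\mathit{Leaf}(\mathit{Var}(v)))$, and $\mathit{has}\text{ - }\mathit{var}(v,a)\wedge a\in l \Rightarrow \mathit{has}\text{ - }\mathit{var}(v,\mathit{Node}(l))$. $\mathit{safe}((h,b))$ iff every $v$ with $\mathit{has}\text{ - }\mathit{var}(v,h)$ satisfies $\mathit{has}\text{ - }\mathit{var}(v,a')$ for some atom $a'$ with $(\mathit{Pos},\mathit{True}(a'))\in b$. For an agent (fact) $a$, let $\hat a$ be the atom obtained by replacing each leaf $\mathit{Leaf}(s)$ with $\mathit{Leaf}(\mathit{Lit}(s))$. Define $\mathit{reflect}\text{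 - }\mathit{author}((h,b),a) := (\mathit{Node}([\hat a, \mathit{Leaf}(\mathit{Lit}(\text{"says"})), h]),\ b)$. -}

module Defs where

open import Data.String using (String)
open import Data.List using (List; []; _∷_)
open import Data.List.Membership.Propositional using (_∈_)
open import Data.Product using (_×_; _,_; ∃-syntax)

data Rosetree (T : Set) : Set where
  Leaf : T → Rosetree T
  Node : List (Rosetree T) → Rosetree T

Fact : Set
Fact = Rosetree String

Agent : Set
Agent = Fact

data Constant : Set where
  Var : String → Constant
  Lit : String → Constant

Atom : Set
Atom = Rosetree Constant

data Sign : Set where
  Pos Neg : Sign

data Condition : Set where
  True : Atom → Condition
  Same : List Atom → Condition
  Diff : List Atom → Condition

Rule : Set
Rule = Atom × List (Sign × Condition)

data HasVar (v : String) : Atom → Set where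
  hv-leaf : HasVar v (Leaf (Var v))
  hv-node : ∀ {a l} → HasVar v a → a ∈ l → HasVar v (Node l)

Safe : Rule → Set
Safe (h , b) = ∀ v → HasVar v h → ∃[ a' ] (HasVar v a' × (Pos , True a') ∈ b)

mutual
  liftFact : Fact → Atom
  liftFact (Leaf s) = Leaf (Lit s)
  liftFact (Node l) = Node (liftFacts l)

  liftFacts : List Fact → List Atom
  liftFacts [] = []
  liftFacts (x ∷ xs) = liftFact x ∷ liftFacts xs

reflectAuthor : Rule → Agent → Rule
reflectAuthor (h , b) a = Node (liftFact a ∷ Leaf (Lit "says") ∷ h ∷ []) , b

{-# OPTIONS --safe #-}
module Submission where

open import Defs
open import Data.List using ([]; _∷_)
open import Data.List.Relation.Unary.Any using (here; there)
open import Data.List.Membership.Propositional using (_∈_)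
open import Data.Product using (_,_)
open import Data.Empty using (⊥-elim)
open import Relation.Nullary using (¬_)
open import Relation.Binary.PropositionalEquality using (refl)

mutual
  liftFact-ground : ∀ {v} f → ¬ HasVar v (liftFact f)
  liftFact-ground (Node l) (hv-node p a∈l) = liftFacts-ground l p a∈l

  liftFacts-ground : ∀ {v a} l → HasVar v a → ¬ a ∈ liftFacts l
  liftFacts-ground (f ∷ fs) p (here refl) = liftFact-ground f p
  liftFacts-ground (f ∷ fs) p (there a∈l) = liftFacts-ground fs p a∈l

safe-restrictHead : ∀ {h h′ b} → (∀ {v} → HasVar v h′ → HasVar v h) →
                    Safe (h , b) → Safe (h′ , b)
safe-restrictHead h′⊆h safe v p = safe v (h′⊆h p)

says-hasVar : ∀ {v h} a →
              HasVar v (Node (liftFact a ∷ Leaf (Lit "says") ∷ h ∷ [])) → HasVar v h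
says-hasVar a (hv-node p (here refl))                 = ⊥-elim (liftFact-ground a p)
says-hasVar a (hv-node () (there (here refl)))
says-hasVar a (hv-node p (there (there (here refl)))) = p

mainTheorem8 : (r : Rule) (a : Agent) → Safe r → Safe (reflectAuthor r a)
mainTheorem8 (h , b) a = safe-restrictHead (says-hasVar a)
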